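{- Let $q$ be an odd prime power with $q \equiv 3 \pmod 4$. Let $i, j \in F_q^{\ast}$ and let $X, Y \in F_q^2$ be distinct points with $k = Q(X,Y) \neq 0$. Let $f(i,j,k) = ij - (k-i-j)^2/4$. Then the number of points $Z \in F_q^2$ with $Q(X,Z) = i$ and $Q(Y,Z) = j$ depends only on $i,j,k$, and equals $0$ if $f(i,j,k)$ is a non-square in $F_q$, $1$ if $f(i,j,k) = 0$, and $2$ if $f(i,j,k)$ is a nonzero square in $F_q$.
   Context: $F_q$ is the finite field with $q$ elements; the quadrance of $[x_1,y_1],[x_2,y_2] \in F_q^2$ is $Q = (x_2-x_1)^2 + (y_2-y_1)^2$. -}

module Defs where

open import Data.Nat as ℕ using (ℕ; suc)
open import Data.Nat.Primality using (Prime)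
open import Data.Fin as Fin using (Fin)
open import Data.List using (List; length; filter; map; cartesianProduct)
open import Data.Product using (_×_; _,_; ∃)
open import Relation.Binary.PropositionalEquality using (_≡_; _≢_; cong; trans; sym)
open import Relation.Nullary using (Dec; yes; no; ¬_)
open import Relation.Nullary.Decidable using (_×-dec_)
open import Algebra.Core using (Op₁; Op₂)
open import Algebra.Structures using (IsCommutativeRing)
open import Function.Bundles using (_↔_; Inverse)
open import Data.List using () renaming (allFin to allFinList)

IsPrimePower : ℕ → Set
IsPrimePower q = ∃ λ p → ∃ λ n → Prime p × q ≡ p ℕ.^ suc n

record FiniteField (q : ℕ) : Set₁ where
  infixl 6 _+_ _-_
  infixl 7 _*_
  field
    Carrier : Set
    _+_ _*_ : Op₂ Carrier
    -_ : Op₁ Carrier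
    0# 1# : Carrier
    isCommutativeRing : IsCommutativeRing _≡_ _+_ _*_ -_ 0# 1#
    0≢1 : 0# ≢ 1#
    _⁻¹ : Op₁ Carrier
    inverse : ∀ x → x ≢ 0# → x * (x ⁻¹) ≡ 1#
    enum : Carrier ↔ Fin q

  _-_ : Op₂ Carrier
  x - y = x + (- y)

  _² : Op₁ Carrier
  x ² = x * x

  2# 4# : Carrier
  2# = 1# + 1#
  4# = 2# + 2#

  _≟_ : (x y : Carrier) → Dec (x ≡ y)
  x ≟ y with Inverse.to enum x Fin.≟ Inverse.to enum y
  ... | yes p = yes (trans (sym (Inverse.strictlyInverseʳ enum x))
                      (trans (cong (Inverse.from enum) p) (Inverse.strictlyInverseʳ enum y)))
  ... | no ¬p = no (λ e → ¬p (cong (Inverse.to enum) e))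

  elements : List Carrier
  elements = map (Inverse.from enum) (allFinList q)

  Point : Set
  Point = Carrier × Carrier

  points : List Point
  points = cartesianProduct elements elements

  Q : Point → Point → Carrier
  Q (x₁ , y₁) (x₂ , y₂) = (x₂ - x₁) ² + (y₂ - y₁) ²

  count : Point → Point → Carrier → Carrier → ℕ
  count X Y i j = length (filter (λ Z → (Q X Z ≟ i) ×-dec (Q Y Z ≟ j)) points)

  f : Carrier → Carrier → Carrier → Carrier
  f i j k = i * j - ((k - i - j) ²) * (4# ⁻¹)

  IsSquare : Carrier → Set
  IsSquare x = ∃ λ y → y * y ≡ x

{-# OPTIONS --safe #-}
-- Put d = Y - X = (a , b), k = Q(X,Y) = a² + b² ≠ 0, and write every point as
-- Z = X + (s d + t d⊥) / k with d⊥ = (- b , a).  Then Q(X,Z) k = s² + t² (Brahmagupta–Fibonacci)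
-- and Q(Y,Z) = Q(X,Z) - 2 s + k, so Z lies on both circles iff s = (i + k - j) / 2 and
-- t² = i k - s², which equals f(i,j,k).  The points Z therefore correspond to the square roots
-- t of f(i,j,k), of which there are 0, 1 or 2 because 2 ≠ 0 in a field of odd order.
module Submission where

open import Defs
open import Level using (0ℓ)
open import Algebra.Bundles using (CommutativeRing)
open import Algebra.Solver.Ring.AlmostCommutativeRing
  using (_-Raw-AlmostCommutative⟶_; fromCommutativeRing)
open import Data.Nat as ℕ using (ℕ; zero; suc; _<_; _%_)
import Data.Nat.Properties as ℕ
open import Data.Nat.DivMod using (m*n%n≡0)
import Data.Integer as ℤ
open ℤ using (ℤ; -[1+_]; _⊖_)
import Data.Integer.Properties as ℤ
open import Data.Fin using (toℕ)
open import Data.Fin.Properties using (toℕ-injective)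
open import Data.Maybe using (Maybe; just; nothing)
open import Data.Empty using (⊥-elim)
open import Data.Product using (∃; _×_; _,_; proj₂)
open import Data.Sum using (_⊎_; inj₁; inj₂; [_,_]′; reduce)
open import Data.List using (List; []; _∷_; [_]; length; filter; map; _++_; allFin)
open import Data.List.Properties using (length-++; length-map; length-tabulate)
open import Data.List.Membership.Propositional using (_∈_)
open import Data.List.Membership.Propositional.Properties
  using (∈-filter⁺; ∈-filter⁻; ∈-map⁺; ∈-map⁻; ∈-++⁺ˡ; ∈-++⁺ʳ; ∈-allFin; ∈-cartesianProduct⁺)
open import Data.List.Membership.Propositional.Properties.WithK using (unique∧set⇒bag)
open import Data.List.Relation.Unary.Any using (here; there)
open import Data.List.Relation.Unary.All as All using ()
open import Data.List.Relation.Unary.AllPairs as AllPairs using ()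
open import Data.List.Relation.Unary.Unique.Propositional using (Unique)
import Data.List.Relation.Unary.Unique.Propositional.Properties as Unique
open import Data.List.Relation.Binary.BagAndSetEquality using (_∼[_]_; set; ∼bag⇒↭)
open import Data.List.Relation.Binary.Permutation.Propositional.Properties using (↭-length)
open import Function.Bundles using (Inverse; _⇔_; mk⇔; Equivalence)
open import Relation.Nullary using (¬_; yes; no; contradiction)
open import Relation.Nullary.Decidable using (_×-dec_)
open import Relation.Unary using (Decidable)
open import Relation.Binary using (tri<; tri≈; tri>)
import Relation.Binary.PropositionalEquality as ≡
open ≡ using (_≡_; _≢_)

-- The ring solver decides equality of coefficients by evaluation, which the abstract field does
-- not allow; so its coefficients are taken in ℤ, which maps into every commutative ring.
module IntegerCoefficientSolver {c ℓ} (R : CommutativeRing c ℓ) where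
  open CommutativeRing R
  open import Algebra.Properties.Semiring.Mult.TCOptimised semiring
    using (1+×; ×-homo-+; ×1-homo-*) renaming (_×_ to _·_)
  open import Algebra.Properties.Ring ring
    using (-0#≈0#; -‿involutive; -‿distribˡ-*; -‿distribʳ-*; -‿+-comm; xyx⁻¹≈y)
  open import Relation.Binary.Reasoning.Setoid setoid

  fromℤ : ℤ → Carrier
  fromℤ (ℤ.+ n)    = n · 1#
  fromℤ -[1+ n ]  = - (suc n · 1#)

  private
    [x+y]-[x+z]≈y-z : ∀ x y z → (x + y) - (x + z) ≈ y - z
    [x+y]-[x+z]≈y-z x y z = begin
      (x + y) + - (x + z)   ≈⟨ +-congˡ (-‿+-comm x z) ⟨
      (x + y) + (- x + - z) ≈⟨ +-assoc (x + y) (- x) (- z) ⟨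
      (x + y) + - x + - z   ≈⟨ +-congʳ (xyx⁻¹≈y x y) ⟩
      y - z                 ∎

  fromℤ-⊖ : ∀ m n → fromℤ (m ⊖ n) ≈ m · 1# - n · 1#
  fromℤ-⊖ zero    zero    = sym (-‿inverseʳ 0#)
  fromℤ-⊖ (suc m) zero    = sym (trans (+-congˡ -0#≈0#) (+-identityʳ _))
  fromℤ-⊖ zero    (suc n) = sym (+-identityˡ _)
  fromℤ-⊖ (suc m) (suc n) = begin
    fromℤ (suc m ⊖ suc n)               ≡⟨ ≡.cong fromℤ (ℤ.[1+m]⊖[1+n]≡m⊖n m n) ⟩
    fromℤ (m ⊖ n)                       ≈⟨ fromℤ-⊖ m n ⟩
    m · 1# - n · 1#                     ≈⟨ [x+y]-[x+z]≈y-z 1# (m · 1#) (n · 1#) ⟨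
    (1# + m · 1#) - (1# + n · 1#)       ≈⟨ +-cong (1+× m 1#) (-‿cong (1+× n 1#)) ⟨
    suc m · 1# - suc n · 1#             ∎

  fromℤ-+ : ∀ x y → fromℤ (x ℤ.+ y) ≈ fromℤ x + fromℤ y
  fromℤ-+ (ℤ.+ m)  (ℤ.+ n)  = ×-homo-+ 1# m n
  fromℤ-+ (ℤ.+ m)  -[1+ n ] = fromℤ-⊖ m (suc n)
  fromℤ-+ -[1+ m ] (ℤ.+ n)  = trans (fromℤ-⊖ n (suc m)) (+-comm _ _)
  fromℤ-+ -[1+ m ] -[1+ n ] = begin
    - (suc (suc (m ℕ.+ n)) · 1#)          ≡⟨ ≡.cong (λ s → - (suc s · 1#)) (ℕ.+-suc m n) ⟨
    - ((suc m ℕ.+ suc n) · 1#)            ≈⟨ -‿cong (×-homo-+ 1# (suc m) (suc n)) ⟩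
    - (suc m · 1# + suc n · 1#)           ≈⟨ -‿+-comm _ _ ⟨
    - (suc m · 1#) + - (suc n · 1#)       ∎

  fromℤ-* : ∀ x y → fromℤ (x ℤ.* y) ≈ fromℤ x * fromℤ y
  fromℤ-* (ℤ.+ m)     (ℤ.+ n)     = trans (reflexive (≡.cong fromℤ (ℤ.+◃n≡+n (m ℕ.* n)))) (×1-homo-* m n)
  fromℤ-* (ℤ.+ zero)  -[1+ n ]    = sym (zeroˡ _)
  fromℤ-* (ℤ.+ suc m) -[1+ n ]    = trans (-‿cong (×1-homo-* (suc m) (suc n))) (-‿distribʳ-* _ _)
  fromℤ-* -[1+ m ]    (ℤ.+ zero)  rewrite ℕ.*-zeroʳ m = sym (zeroʳ _)
  fromℤ-* -[1+ m ]    (ℤ.+ suc n) = trans (-‿cong (×1-homo-* (suc m) (suc n))) (-‿distribˡ-* _ _)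
  fromℤ-* -[1+ m ]    -[1+ n ]    = begin
    (suc m ℕ.* suc n) · 1#                ≈⟨ ×1-homo-* (suc m) (suc n) ⟩
    suc m · 1# * suc n · 1#               ≈⟨ -‿involutive _ ⟨
    - - (suc m · 1# * suc n · 1#)         ≈⟨ -‿cong (-‿distribʳ-* _ _) ⟩
    - (suc m · 1# * - (suc n · 1#))       ≈⟨ -‿distribˡ-* _ _ ⟩
    - (suc m · 1#) * - (suc n · 1#)       ∎

  fromℤ-neg : ∀ x → fromℤ (ℤ.- x) ≈ - fromℤ x
  fromℤ-neg (ℤ.+ zero)  = sym -0#≈0#
  fromℤ-neg (ℤ.+ suc n) = refl
  fromℤ-neg -[1+ n ]    = sym (-‿involutive _)

  fromℤ-morphism : ℤ.+-*-rawRing -Raw-AlmostCommutative⟶ fromCommutativeRing R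
  fromℤ-morphism = record
    { ⟦_⟧    = fromℤ
    ; +-homo = fromℤ-+
    ; *-homo = fromℤ-*
    ; -‿homo = fromℤ-neg
    ; 0-homo = refl
    ; 1-homo = refl
    }

  fromℤ-≟ : ∀ x y → Maybe (fromℤ x ≈ fromℤ y)
  fromℤ-≟ x y with x ℤ.≟ y
  ... | yes ≡.refl = just refl
  ... | no _       = nothing

  open import Algebra.Solver.Ring ℤ.+-*-rawRing (fromCommutativeRing R) fromℤ-morphism fromℤ-≟ public
    using (solve; _:=_; _:+_; _:*_; _:-_; :-_; con)

open ≡ using (refl; sym; trans; cong; cong₂; subst; module ≡-Reasoning)

module _ {A : Set} where

  unique∧set⇒length≡ : ∀ {xs ys : List A} → Unique xs → Unique ys → xs ∼[ set ] ys →
                       length xs ≡ length ys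
  unique∧set⇒length≡ xs! ys! xs∼ys = ↭-length (∼bag⇒↭ (unique∧set⇒bag xs! ys! xs∼ys))

  length-filter-complete : ∀ {P : A → Set} (P? : Decidable P) {xs ys : List A} →
                           Unique xs → (∀ x → x ∈ xs) → Unique ys → (∀ {x} → P x ⇔ x ∈ ys) →
                           length (filter P? xs) ≡ length ys
  length-filter-complete P? {xs} xs! ∈xs ys! P⇔∈ys = unique∧set⇒length≡ (Unique.filter⁺ P? {xs} xs!) ys!
    λ {x} → mk⇔ (λ x∈ → Equivalence.to P⇔∈ys (proj₂ (∈-filter⁻ P? {xs = xs} x∈)))
                (λ x∈ → ∈-filter⁺ P? (∈xs x) (Equivalence.from P⇔∈ys x∈))

module _ {A : Set} (rank : A → ℕ) (rank-injective : ∀ {x y} → rank x ≡ rank y → x ≡ y)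
         (g : A → A) (g-involutive : ∀ x → g (g x) ≡ x) (g-fixpoint-free : ∀ x → g x ≢ x) where

  private
    Lower : A → Set
    Lower x = rank x < rank (g x)

    lower? : Decidable Lower
    lower? x = rank x ℕ.<? rank (g x)

    lower-or-image : ∀ x → Lower x ⊎ Lower (g x)
    lower-or-image x with ℕ.<-cmp (rank x) (rank (g x))
    ... | tri< x<gx _ _ = inj₁ x<gx
    ... | tri≈ _ x≡gx _ = contradiction (sym (rank-injective x≡gx)) (g-fixpoint-free x)
    ... | tri> _ _ gx<x = inj₂ (subst (rank (g x) <_) (cong rank (sym (g-involutive x))) gx<x)

    lower⇒image-not-lower : ∀ {x} → Lower x → ¬ Lower (g x)
    lower⇒image-not-lower {x} x<gx gx<ggx =
      ℕ.<-asym x<gx (subst (rank (g x) <_) (cong rank (g-involutive x)) gx<ggx)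

    g-injective : ∀ {x y} → g x ≡ g y → x ≡ y
    g-injective {x} {y} gx≡gy = trans (sym (g-involutive x)) (trans (cong g gx≡gy) (g-involutive y))

  -- Each orbit {x, g x} of the involution is listed exactly once through its element of lower rank.
  fixpointFreeInvolution⇒length-even : ∀ {xs} → Unique xs → (∀ x → x ∈ xs) →
                                       ∃ λ m → length xs ≡ 2 ℕ.* m
  fixpointFreeInvolution⇒length-even {xs} xs! ∈xs = length lower , (begin
    length xs                              ≡⟨ unique∧set⇒length≡ xs! lower++image! xs∼lower++image ⟩
    length (lower ++ map g lower)          ≡⟨ length-++ lower ⟩
    length lower ℕ.+ length (map g lower)  ≡⟨ cong (length lower ℕ.+_) (length-map g lower) ⟩
    length lower ℕ.+ length lower          ≡⟨ cong (length lower ℕ.+_) (ℕ.+-identityʳ _) ⟨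
    2 ℕ.* length lower                     ∎)
    where
    open ≡-Reasoning
    lower : List A
    lower = filter lower? xs

    lower! : Unique lower
    lower! = Unique.filter⁺ lower? {xs} xs!

    lower++image! : Unique (lower ++ map g lower)
    lower++image! = Unique.++⁺ lower! (Unique.map⁺ g-injective lower!) disjoint
      where
      disjoint : ∀ {x} → ¬ (x ∈ lower × x ∈ map g lower)
      disjoint (x∈lower , x∈image) with ∈-map⁻ g x∈image
      ... | y , y∈lower , refl =
        lower⇒image-not-lower (proj₂ (∈-filter⁻ lower? {xs = xs} y∈lower))
                              (proj₂ (∈-filter⁻ lower? {xs = xs} x∈lower))

    xs∼lower++image : xs ∼[ set ] (lower ++ map g lower)
    xs∼lower++image {x} = mk⇔ (λ _ → ∈lower++image x) (λ _ → ∈xs x)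
      where
      ∈lower++image : ∀ x → x ∈ lower ++ map g lower
      ∈lower++image x with lower-or-image x
      ... | inj₁ x-lower  = ∈-++⁺ˡ (∈-filter⁺ lower? (∈xs x) x-lower)
      ... | inj₂ gx-lower = ∈-++⁺ʳ lower
        (subst (_∈ map g lower) (g-involutive x) (∈-map⁺ g (∈-filter⁺ lower? (∈xs (g x)) gx-lower)))

module FiniteFieldProperties {q : ℕ} (F : FiniteField q) where
  open FiniteField F
  open ≡-Reasoning

  commutativeRing : CommutativeRing 0ℓ 0ℓ
  commutativeRing = record { isCommutativeRing = isCommutativeRing }

  open CommutativeRing commutativeRing public
    using (+-assoc; *-assoc; *-comm; +-identityʳ; *-identityˡ; *-identityʳ; zeroˡ; zeroʳ; -‿inverseʳ)
  open import Algebra.Properties.Ring (CommutativeRing.ring commutativeRing)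
    using (+-inverseˡ-unique; x∙y⁻¹≈ε⇒x≈y)
  open IntegerCoefficientSolver commutativeRing public

  ∈-elements : ∀ x → x ∈ elements
  ∈-elements x = subst (_∈ elements) (Inverse.strictlyInverseʳ enum x)
                   (∈-map⁺ (Inverse.from enum) (∈-allFin (Inverse.to enum x)))

  elements-unique : Unique elements
  elements-unique = Unique.map⁺ from-injective (Unique.allFin⁺ q)
    where
    from-injective : ∀ {m n} → Inverse.from enum m ≡ Inverse.from enum n → m ≡ n
    from-injective {m} {n} e = trans (sym (Inverse.strictlyInverseˡ enum m))
                                 (trans (cong (Inverse.to enum) e) (Inverse.strictlyInverseˡ enum n))

  length-elements : length elements ≡ q
  length-elements = trans (length-map (Inverse.from enum) (allFin q)) (length-tabulate (λ i → i))

  ∈-points : ∀ Z → Z ∈ points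
  ∈-points (x , y) = ∈-cartesianProduct⁺ (∈-elements x) (∈-elements y)

  points-unique : Unique points
  points-unique = Unique.cartesianProduct⁺ elements-unique elements-unique

  [x*y]*x⁻¹≡y : ∀ {x} y → x ≢ 0# → (x * y) * x ⁻¹ ≡ y
  [x*y]*x⁻¹≡y {x} y x≢0 = begin
    (x * y) * x ⁻¹   ≡⟨ solve 3 (λ x x⁻¹ y → (x :* y) :* x⁻¹ := (x :* x⁻¹) :* y) refl x (x ⁻¹) y ⟩
    (x * x ⁻¹) * y   ≡⟨ cong (_* y) (inverse x x≢0) ⟩
    1# * y           ≡⟨ *-identityˡ y ⟩
    y                ∎

  *-cancelˡ : ∀ {x y z} → x ≢ 0# → x * y ≡ x * z → y ≡ z
  *-cancelˡ {x} {y} {z} x≢0 xy≡xz =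
    trans (sym ([x*y]*x⁻¹≡y y x≢0)) (trans (cong (_* x ⁻¹) xy≡xz) ([x*y]*x⁻¹≡y z x≢0))

  x*y≡0⇒x≡0⊎y≡0 : ∀ {x y} → x * y ≡ 0# → x ≡ 0# ⊎ y ≡ 0#
  x*y≡0⇒x≡0⊎y≡0 {x} {y} xy≡0 with x ≟ 0#
  ... | yes x≡0 = inj₁ x≡0
  ... | no x≢0  = inj₂ (*-cancelˡ x≢0 (trans xy≡0 (sym (zeroʳ x))))

  x²≡y²⇒x≡±y : ∀ {x y} → x ² ≡ y ² → x ≡ y ⊎ x ≡ - y
  x²≡y²⇒x≡±y {x} {y} x²≡y² with x*y≡0⇒x≡0⊎y≡0 (begin
    (x - y) * (x + y) ≡⟨ solve 2 (λ x y → (x :- y) :* (x :+ y) := x :* x :- y :* y) refl x y ⟩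
    x ² - y ²         ≡⟨ cong (_- y ²) x²≡y² ⟩
    y ² - y ²         ≡⟨ -‿inverseʳ (y ²) ⟩
    0#                ∎)
  ... | inj₁ x-y≡0 = inj₁ (x∙y⁻¹≈ε⇒x≈y x y x-y≡0)
  ... | inj₂ x+y≡0 = inj₂ (+-inverseˡ-unique x y x+y≡0)

  2#≢0# : q % 2 ≡ 1 → 2# ≢ 0#
  2#≢0# q-odd 2≡0 with fixpointFreeInvolution⇒length-even rank rank-injective
                         (_+ 1#) +1-involutive +1-fixpoint-free elements-unique ∈-elements
    where
    rank : Carrier → ℕ
    rank x = toℕ (Inverse.to enum x)
    rank-injective : ∀ {x y} → rank x ≡ rank y → x ≡ y
    rank-injective {x} {y} e = trans (sym (Inverse.strictlyInverseʳ enum x))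
      (trans (cong (Inverse.from enum) (toℕ-injective e)) (Inverse.strictlyInverseʳ enum y))
    +1-involutive : ∀ x → x + 1# + 1# ≡ x
    +1-involutive x = trans (+-assoc x 1# 1#) (trans (cong (x +_) 2≡0) (+-identityʳ x))
    +1-fixpoint-free : ∀ x → x + 1# ≢ x
    +1-fixpoint-free x x+1≡x = 0≢1 (sym (begin
      1#            ≡⟨ solve 2 (λ x o → o := x :+ o :- x) refl x 1# ⟩
      x + 1# - x    ≡⟨ cong (_- x) x+1≡x ⟩
      x - x         ≡⟨ -‿inverseʳ x ⟩
      0#            ∎))
  ... | m , |elements|≡2m = ℕ.0≢1+n (begin
    0               ≡⟨ m*n%n≡0 m 2 ⟨
    (m ℕ.* 2) % 2   ≡⟨ cong (_% 2) (ℕ.*-comm m 2) ⟩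
    (2 ℕ.* m) % 2   ≡⟨ cong (_% 2) (trans (sym |elements|≡2m) length-elements) ⟩
    q % 2           ≡⟨ q-odd ⟩
    1               ∎)

  SquareRoots : Carrier → List Carrier → Set
  SquareRoots x ws = Unique ws × (∀ {w} → w ² ≡ x ⇔ w ∈ ws)

  squareRoots-nonSquare : ∀ {x} → ¬ IsSquare x → SquareRoots x []
  squareRoots-nonSquare ¬□x = AllPairs.[] , λ {w} → mk⇔ (λ w²≡x → ⊥-elim (¬□x (w , w²≡x))) (λ ())

  squareRoots-0# : SquareRoots 0# [ 0# ]
  squareRoots-0# = All.[] AllPairs.∷ AllPairs.[] , mk⇔ to from
    where
    to : ∀ {w} → w ² ≡ 0# → w ∈ [ 0# ]
    to w²≡0 = here (reduce (x*y≡0⇒x≡0⊎y≡0 w²≡0))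
    from : ∀ {w} → w ∈ [ 0# ] → w ² ≡ 0#
    from (here refl) = zeroˡ 0#

  squareRoots-square : 2# ≢ 0# → ∀ {s} → s ≢ 0# → SquareRoots (s ²) (s ∷ - s ∷ [])
  squareRoots-square 2≢0 {s} s≢0 =
    (s≢-s All.∷ All.[]) AllPairs.∷ All.[] AllPairs.∷ AllPairs.[] , mk⇔ to from
    where
    s≢-s : s ≢ - s
    s≢-s s≡-s = s≢0 (*-cancelˡ 2≢0 (begin
      2# * s       ≡⟨ solve 1 (λ s → con (ℤ.+ 2) :* s := s :- :- s) refl s ⟩
      s - - s      ≡⟨ cong (_- - s) s≡-s ⟩
      - s - - s    ≡⟨ -‿inverseʳ (- s) ⟩
      0#           ≡⟨ zeroʳ 2# ⟨
      2# * 0#      ∎))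
    to : ∀ {w} → w ² ≡ s ² → w ∈ s ∷ - s ∷ []
    to w²≡s² with x²≡y²⇒x≡±y w²≡s²
    ... | inj₁ w≡s  = here w≡s
    ... | inj₂ w≡-s = there (here w≡-s)
    from : ∀ {w} → w ∈ s ∷ - s ∷ [] → w ² ≡ s ²
    from (here refl)         = refl
    from (there (here refl)) = solve 1 (λ s → :- s :* :- s := s :* s) refl s

  module CircleIntersection (2≢0 : 2# ≢ 0#) (x₁ y₁ x₂ y₂ : Carrier) (k≢0 : Q (x₁ , y₁) (x₂ , y₂) ≢ 0#)
                            (i j : Carrier) where

    X Y : Point
    X = x₁ , y₁
    Y = x₂ , y₂

    a b k c : Carrier
    a = x₂ - x₁
    b = y₂ - y₁
    k = Q X Y
    c = 2# ⁻¹ * (i + k - j)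

    along across : Point → Carrier
    along  (x , y) = a * (x - x₁) + b * (y - y₁)
    across (x , y) = a * (y - y₁) - b * (x - x₁)

    frame : Carrier → Carrier → Point
    frame s t = x₁ + (s * a - t * b) * k ⁻¹ , y₁ + (s * b + t * a) * k ⁻¹

    QX*k≡along²+across² : ∀ Z → Q X Z * k ≡ along Z ² + across Z ²
    QX*k≡along²+across² (x , y) = solve 4 (λ u v a b →
        (u :* u :+ v :* v) :* (a :* a :+ b :* b)
      := (a :* u :+ b :* v) :* (a :* u :+ b :* v) :+ (a :* v :- b :* u) :* (a :* v :- b :* u))
      refl (x - x₁) (y - y₁) a b

    QY≡QX-2*along+k : ∀ Z → Q Y Z ≡ Q X Z - 2# * along Z + k
    QY≡QX-2*along+k (x , y) = solve 6 (λ x y x₁ y₁ x₂ y₂ →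
        (x :- x₂) :* (x :- x₂) :+ (y :- y₂) :* (y :- y₂)
      := (x :- x₁) :* (x :- x₁) :+ (y :- y₁) :* (y :- y₁)
         :- con (ℤ.+ 2) :* ((x₂ :- x₁) :* (x :- x₁) :+ (y₂ :- y₁) :* (y :- y₁))
         :+ ((x₂ :- x₁) :* (x₂ :- x₁) :+ (y₂ :- y₁) :* (y₂ :- y₁)))
      refl x y x₁ y₁ x₂ y₂

    x*[k*k⁻¹]≡x : ∀ s → s * (k * k ⁻¹) ≡ s
    x*[k*k⁻¹]≡x s = trans (cong (s *_) (inverse k k≢0)) (*-identityʳ s)

    along-frame : ∀ s t → along (frame s t) ≡ s
    along-frame s t = trans (solve 7 (λ x₁ y₁ a b s t K →
        a :* ((x₁ :+ (s :* a :- t :* b) :* K) :- x₁) :+ b :* ((y₁ :+ (s :* b :+ t :* a) :* K) :- y₁)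
      := s :* ((a :* a :+ b :* b) :* K))
      refl x₁ y₁ a b s t (k ⁻¹)) (x*[k*k⁻¹]≡x s)

    across-frame : ∀ s t → across (frame s t) ≡ t
    across-frame s t = trans (solve 7 (λ x₁ y₁ a b s t K →
        a :* ((y₁ :+ (s :* b :+ t :* a) :* K) :- y₁) :- b :* ((x₁ :+ (s :* a :- t :* b) :* K) :- x₁)
      := t :* ((a :* a :+ b :* b) :* K))
      refl x₁ y₁ a b s t (k ⁻¹)) (x*[k*k⁻¹]≡x t)

    frame-along-across : ∀ Z → frame (along Z) (across Z) ≡ Z
    frame-along-across (x , y) = cong₂ _,_
      (begin
        x₁ + (along (x , y) * a - across (x , y) * b) * k ⁻¹
          ≡⟨ solve 7 (λ x y x₁ y₁ a b K →
                x₁ :+ ((a :* (x :- x₁) :+ b :* (y :- y₁)) :* a :- (a :* (y :- y₁) :- b :* (x :- x₁)) :* b) :* K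
              := x₁ :+ (x :- x₁) :* ((a :* a :+ b :* b) :* K))
              refl x y x₁ y₁ a b (k ⁻¹) ⟩
        x₁ + (x - x₁) * (k * k ⁻¹)  ≡⟨ cong (x₁ +_) (x*[k*k⁻¹]≡x (x - x₁)) ⟩
        x₁ + (x - x₁)               ≡⟨ solve 2 (λ x x₁ → x₁ :+ (x :- x₁) := x) refl x x₁ ⟩
        x                           ∎)
      (begin
        y₁ + (along (x , y) * b + across (x , y) * a) * k ⁻¹
          ≡⟨ solve 7 (λ x y x₁ y₁ a b K →
                y₁ :+ ((a :* (x :- x₁) :+ b :* (y :- y₁)) :* b :+ (a :* (y :- y₁) :- b :* (x :- x₁)) :* a) :* K
              := y₁ :+ (y :- y₁) :* ((a :* a :+ b :* b) :* K))
              refl x y x₁ y₁ a b (k ⁻¹) ⟩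
        y₁ + (y - y₁) * (k * k ⁻¹)  ≡⟨ cong (y₁ +_) (x*[k*k⁻¹]≡x (y - y₁)) ⟩
        y₁ + (y - y₁)               ≡⟨ solve 2 (λ y y₁ → y₁ :+ (y :- y₁) := y) refl y y₁ ⟩
        y                           ∎)

    2#*c : 2# * c ≡ i + k - j
    2#*c = begin
      2# * (2# ⁻¹ * (i + k - j))  ≡⟨ *-assoc 2# (2# ⁻¹) (i + k - j) ⟨
      (2# * 2# ⁻¹) * (i + k - j)  ≡⟨ cong (_* (i + k - j)) (inverse 2# 2≢0) ⟩
      1# * (i + k - j)            ≡⟨ *-identityˡ (i + k - j) ⟩
      i + k - j                   ∎

    f≡i*k-c² : f i j k ≡ i * k - c ²
    f≡i*k-c² = begin
      f i j k                            ≡⟨ cong (λ j → f i j k) j≡j′ ⟩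
      i * j′ - (k - i - j′) ² * 4# ⁻¹    ≡⟨ cong (λ z → i * j′ - z * 4# ⁻¹) [k-i-j′]²≡4[c-i]² ⟩
      i * j′ - (4# * (c - i) ²) * 4# ⁻¹  ≡⟨ cong (λ z → i * j′ - z) ([x*y]*x⁻¹≡y ((c - i) ²) 4≢0) ⟩
      i * j′ - (c - i) ²                 ≡⟨ solve 3 (λ i k c →
                                              i :* (i :+ k :- con (ℤ.+ 2) :* c) :- (c :- i) :* (c :- i)
                                            := i :* k :- c :* c) refl i k c ⟩
      i * k - c ²                        ∎
      where
      j′ : Carrier
      j′ = i + k - 2# * c
      j≡j′ : j ≡ j′
      j≡j′ = trans (solve 3 (λ i k j → j := i :+ k :- (i :+ k :- j)) refl i k j)
                   (cong (λ z → i + k - z) (sym 2#*c))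
      [k-i-j′]²≡4[c-i]² : (k - i - j′) ² ≡ 4# * (c - i) ²
      [k-i-j′]²≡4[c-i]² = solve 3 (λ i k c →
          (k :- i :- (i :+ k :- con (ℤ.+ 2) :* c)) :* (k :- i :- (i :+ k :- con (ℤ.+ 2) :* c))
        := (con (ℤ.+ 2) :+ con (ℤ.+ 2)) :* ((c :- i) :* (c :- i))) refl i k c
      4≢0 : 4# ≢ 0#
      4≢0 4≡0 = [ 2≢0 , 2≢0 ]′ (x*y≡0⇒x≡0⊎y≡0 (trans 2#*2#≡4# 4≡0))
        where
        2#*2#≡4# : 2# * 2# ≡ 4#
        2#*2#≡4# = solve 0 (con (ℤ.+ 2) :* con (ℤ.+ 2) := con (ℤ.+ 2) :+ con (ℤ.+ 2)) refl

    Solution : Point → Set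
    Solution Z = Q X Z ≡ i × Q Y Z ≡ j

    solution? : Decidable Solution
    solution? Z = (Q X Z ≟ i) ×-dec (Q Y Z ≟ j)

    solution⇔along∧across : ∀ {Z} → Solution Z ⇔ (along Z ≡ c × across Z ² ≡ f i j k)
    solution⇔along∧across {Z} = mk⇔ to from
      where
      to : Solution Z → along Z ≡ c × across Z ² ≡ f i j k
      to (Q-X-Z≡i , Q-Y-Z≡j) = along≡c , across²≡f
        where
        along≡c : along Z ≡ c
        along≡c = *-cancelˡ 2≢0 (begin
          2# * along Z                           ≡⟨ solve 3 (λ P A k → con (ℤ.+ 2) :* A := P :+ k :- (P :- con (ℤ.+ 2) :* A :+ k))
                                                      refl (Q X Z) (along Z) k ⟩
          Q X Z + k - (Q X Z - 2# * along Z + k) ≡⟨ cong (λ z → Q X Z + k - z) (sym (QY≡QX-2*along+k Z)) ⟩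
          Q X Z + k - Q Y Z                      ≡⟨ cong₂ (λ x y → x + k - y) Q-X-Z≡i Q-Y-Z≡j ⟩
          i + k - j                              ≡⟨ sym 2#*c ⟩
          2# * c                                 ∎)
        across²≡f : across Z ² ≡ f i j k
        across²≡f = begin
          across Z ²                             ≡⟨ solve 2 (λ A T → T :* T := (A :* A :+ T :* T) :- A :* A) refl (along Z) (across Z) ⟩
          (along Z ² + across Z ²) - along Z ²   ≡⟨ cong₂ (λ x y → x - y ²) (sym (QX*k≡along²+across² Z)) along≡c ⟩
          Q X Z * k - c ²                        ≡⟨ cong (λ x → x * k - c ²) Q-X-Z≡i ⟩
          i * k - c ²                            ≡⟨ sym f≡i*k-c² ⟩
          f i j k                                ∎
      from : along Z ≡ c × across Z ² ≡ f i j k → Solution Z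
      from (along≡c , across²≡f) = Q-X-Z≡i , Q-Y-Z≡j
        where
        Q-X-Z≡i : Q X Z ≡ i
        Q-X-Z≡i = *-cancelˡ k≢0 (begin
          k * Q X Z                ≡⟨ *-comm k (Q X Z) ⟩
          Q X Z * k                ≡⟨ QX*k≡along²+across² Z ⟩
          along Z ² + across Z ²   ≡⟨ cong₂ (λ x y → x ² + y) along≡c (trans across²≡f f≡i*k-c²) ⟩
          c ² + (i * k - c ²)      ≡⟨ solve 3 (λ i k c → c :* c :+ (i :* k :- c :* c) := k :* i) refl i k c ⟩
          k * i                    ∎)
        Q-Y-Z≡j : Q Y Z ≡ j
        Q-Y-Z≡j = begin
          Q Y Z                    ≡⟨ QY≡QX-2*along+k Z ⟩
          Q X Z - 2# * along Z + k ≡⟨ cong₂ (λ x y → x - 2# * y + k) Q-X-Z≡i along≡c ⟩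
          i - 2# * c + k           ≡⟨ cong (λ z → i - z + k) 2#*c ⟩
          i - (i + k - j) + k      ≡⟨ solve 3 (λ i k j → i :- (i :+ k :- j) :+ k := j) refl i k j ⟩
          j                        ∎

    count≡length-roots : ∀ {ws} → SquareRoots (f i j k) ws → count X Y i j ≡ length ws
    count≡length-roots {ws} (ws-unique , ∈ws) = begin
      count X Y i j              ≡⟨ length-filter-complete solution? points-unique ∈-points
                                      (Unique.map⁺ frame-c-injective ws-unique) solution⇔∈frames ⟩
      length (map (frame c) ws)  ≡⟨ length-map (frame c) ws ⟩
      length ws                  ∎
      where
      frame-c-injective : ∀ {s t} → frame c s ≡ frame c t → s ≡ t
      frame-c-injective {s} {t} e = trans (sym (across-frame c s)) (trans (cong across e) (across-frame c t))

      ∈frames : ∀ {Z} → along Z ≡ c × across Z ² ≡ f i j k → Z ∈ map (frame c) ws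
      ∈frames {Z} (along≡c , across²≡f) = subst (_∈ map (frame c) ws)
        (trans (cong (λ s → frame s (across Z)) (sym along≡c)) (frame-along-across Z))
        (∈-map⁺ (frame c) (Equivalence.to ∈ws across²≡f))

      frames-solve : ∀ {Z} → ∃ (λ t → t ∈ ws × Z ≡ frame c t) → along Z ≡ c × across Z ² ≡ f i j k
      frames-solve (t , t∈ws , refl) =
        along-frame c t , trans (cong _² (across-frame c t)) (Equivalence.from ∈ws t∈ws)

      solution⇔∈frames : ∀ {Z} → Solution Z ⇔ Z ∈ map (frame c) ws
      solution⇔∈frames {Z} = mk⇔
        (λ sol → ∈frames {Z} (Equivalence.to (solution⇔along∧across {Z}) sol))
        (λ Z∈ → Equivalence.from (solution⇔along∧across {Z}) (frames-solve {Z} (∈-map⁻ (frame c) Z∈)))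

lemma3 : (q : ℕ) → IsPrimePower q → q % 2 ≡ 1 → q % 4 ≡ 3 →
    (F : FiniteField q) →
    let open FiniteField F in
    (i j : Carrier) → i ≢ 0# → j ≢ 0# →
    (X Y : Point) → X ≢ Y → Q X Y ≢ 0# →
    ((¬ IsSquare (f i j (Q X Y)) → count X Y i j ≡ 0)
      × (f i j (Q X Y) ≡ 0# → count X Y i j ≡ 1)
      × (f i j (Q X Y) ≢ 0# → IsSquare (f i j (Q X Y)) → count X Y i j ≡ 2))
lemma3 q _ q-odd _ F i j _ _ (x₁ , y₁) (x₂ , y₂) _ k≢0 =
    (λ ¬□f → count≡length-roots (squareRoots-nonSquare ¬□f))
  , (λ f≡0 → count≡length-roots (subst (λ x → SquareRoots x [ 0# ]) (sym f≡0) squareRoots-0#))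
  , (λ f≢0 (s , s²≡f) → count≡length-roots
       (subst (λ x → SquareRoots x (s ∷ - s ∷ [])) s²≡f (squareRoots-square 2≢0 (s≢0 f≢0 s²≡f))))
  where
  open FiniteField F
  open FiniteFieldProperties F
  2≢0 : 2# ≢ 0#
  2≢0 = 2#≢0# q-odd
  open CircleIntersection 2≢0 x₁ y₁ x₂ y₂ k≢0 i j
  s≢0 : ∀ {x s} → x ≢ 0# → s ² ≡ x → s ≢ 0#
  s≢0 x≢0 s²≡x s≡0 = x≢0 (trans (sym s²≡x) (trans (cong _² s≡0) (zeroˡ 0#)))
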